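{- Let $G$ be a connected simple graph with vertices $v_1,\dots,v_n$ such that $v_1$ and $v_2$ are non-adjacent twins and $t(v_1)=t(v_2)=k$. Then $\frac{k+2}{k}$ is an eigenvalue of $\mathcal D^{\mathcal L}(G)$ with eigenvector $\mathbf{x}=[1,-1,0,\dots,0]^T$.
   Context: Two vertices $u,v$ of a graph are non-adjacent twins if $uv$ is not an edge and $N(u)=N(v)$, where $N(\cdot)$ denotes the set of neighbors. For a connected graph $G$ with vertices $v_1,\dots,v_n$, $d(v_i,v_j)$ is the shortest-path distance, $\mathcal D(G)=(d(v_i,v_j))_{i,j}$ is the distance matrix, $t(v_i)=\sum_j d(v_i,v_j)$ is the transmission of $v_i$, $T(G)=\operatorname{diag}(t(v_1),\dots,t(v_n))$, and the normalized distance Laplacian is $\mathcal D^{\mathcal L}(G)=I-T(G)^{ -1/2}\mathcal D(G)T(G)^{ -1/2}$ (rows and columns indexed in the order $v_1,\dots,v_n$). -}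

module Defs where

open import Level using (Level)
open import Data.Nat using (ℕ; zero; suc; _≤_; _<_) renaming (_+_ to _+ℕ_)
open import Data.Fin using (Fin; zero; suc)
open import Data.Product using (Σ; ∃; _×_; _,_)
open import Relation.Nullary using (¬_)
open import Relation.Binary.PropositionalEquality using (_≡_)
open import Algebra.Bundles using (CommutativeRing)

-- A finite simple graph on the vertex set Fin n (vertex v_{i+1} is index i).
record SimpleGraph (n : ℕ) : Set₁ where
  field
    Adj   : Fin n → Fin n → Set
    sym   : ∀ {u v} → Adj u v → Adj v u
    irrefl : ∀ {u} → ¬ Adj u u
open SimpleGraph public

data Walk {n : ℕ} (G : SimpleGraph n) : Fin n → Fin n → ℕ → Set where
  here : ∀ {u} → Walk G u u 0
  step : ∀ {u w v m} → Adj G u w → Walk G w v m → Walk G u v (suc m)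

Connected : ∀ {n} → SimpleGraph n → Set
Connected G = ∀ u v → ∃ λ m → Walk G u v m

IsDistance : ∀ {n} → SimpleGraph n → (Fin n → Fin n → ℕ) → Set
IsDistance G d = ∀ u v → Walk G u v (d u v) × (∀ m → Walk G u v m → d u v ≤ m)

NonAdjTwins : ∀ {n} → SimpleGraph n → Fin n → Fin n → Set
NonAdjTwins G u v = ¬ Adj G u v × (∀ w → (Adj G u w → Adj G v w) × (Adj G v w → Adj G u w))

sumℕ : ∀ n → (Fin n → ℕ) → ℕ
sumℕ zero    f = 0
sumℕ (suc n) f = f zero +ℕ sumℕ n (λ i → f (suc i))

transmission : ∀ {n} → (Fin n → Fin n → ℕ) → Fin n → ℕ
transmission {n} d u = sumℕ n (d u)

module _ {c ℓ : Level} (R : CommutativeRing c ℓ) where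
  open CommutativeRing R using (Carrier; _≈_; _+_; _*_; -_; _-_; 0#; 1#)

  ι : ℕ → Carrier
  ι zero    = 0#
  ι (suc m) = 1# + ι m

  Σᴿ : ∀ n → (Fin n → Carrier) → Carrier
  Σᴿ zero    f = 0#
  Σᴿ (suc n) f = f zero + Σᴿ n (λ i → f (suc i))

  δ : ∀ {n} → Fin n → Fin n → Carrier
  δ zero    zero    = 1#
  δ zero    (suc _) = 0#
  δ (suc _) zero    = 0#
  δ (suc i) (suc j) = δ i j

  -- isq plays the role of m ↦ m^{-1/2}: a chosen inverse square root of every positive natural.
  IsInvSqrt : (ℕ → Carrier) → Set ℓ
  IsInvSqrt isq = ∀ m → 0 < m → (isq m * isq m) * ι m ≈ 1#

  normDistLap : ∀ {n} → (ℕ → Carrier) → (Fin n → Fin n → ℕ) → Fin n → Fin n → Carrier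
  normDistLap isq d i j =
    δ i j - (isq (transmission d i) * ι (d i j)) * isq (transmission d j)

  mulVec : ∀ {n} → (Fin n → Fin n → Carrier) → (Fin n → Carrier) → Fin n → Carrier
  mulVec {n} M x i = Σᴿ n (λ j → M i j * x j)

  IsEigenpair : ∀ {n} → (Fin n → Fin n → Carrier) → Carrier → (Fin n → Carrier) → Set ℓ
  IsEigenpair {n} M λ' x = (∀ i → mulVec M x i ≈ λ' * x i) × ¬ (∀ i → x i ≈ 0#)

  xVec : ∀ m → Fin (suc (suc m)) → Carrier
  xVec m zero          = 1#
  xVec m (suc zero)    = - 1#
  xVec m (suc (suc _)) = 0#

-- Twins see every other vertex at the same distance, so in rows v ∉ {v₁, v₂} the entries
-- in columns v₁ and v₂ agree and cancel against x = e₁ − e₂. In the rows of the twins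
-- themselves, d(v₁, v₂) = 2 (a common neighbour exists, an edge does not), so the row
-- value is 1 + 2/k, which is (k + 2)/k.
module Submission where

open import Defs
open import Level using (Level)
open import Data.Nat using (ℕ; suc; _+_; _≤_; _<_; z≤n; s≤s)
open import Data.Fin using (Fin; zero; suc)
open import Relation.Nullary using (¬_)
open import Relation.Binary.PropositionalEquality
  using (_≡_; _≢_; ≢-sym; refl; cong₂; subst) renaming (sym to ≡-sym; trans to ≡-trans)
open import Algebra.Bundles using (CommutativeRing)
open import Data.Nat.Properties using (≤-antisym; ≤-trans; n≤0⇒n≡0; m≤m+n; m≤n+m; <-≤-trans)
open import Data.Empty using (⊥-elim)
open import Data.Product using (_,_; proj₁; proj₂)
import Algebra.Properties.Ring as RingProperties
import Relation.Binary.Reasoning.Setoid as SetoidReasoning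

sumℕ-term≤ : ∀ n (f : Fin n → ℕ) (i : Fin n) → f i ≤ sumℕ n f
sumℕ-term≤ (suc n) f zero    = m≤m+n (f zero) _
sumℕ-term≤ (suc n) f (suc i) = ≤-trans (sumℕ-term≤ n (λ j → f (suc j)) i) (m≤n+m _ (f zero))

module _ {n : ℕ} (G : SimpleGraph n) where

  NonAdjTwins-sym : ∀ {u v} → NonAdjTwins G u v → NonAdjTwins G v u
  NonAdjTwins-sym (u≁v , N) = (λ v~u → u≁v (sym G v~u)) , λ w → proj₂ (N w) , proj₁ (N w)

  twins-adj : ∀ {u v w} → NonAdjTwins G u v → Adj G w u → Adj G w v
  twins-adj (_ , N) w~u = sym G (proj₁ (N _) (sym G w~u))

  Walk-retarget⁺ : ∀ {u v w l} → NonAdjTwins G u v → Walk G w u (suc l) → Walk G w v (suc l)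
  Walk-retarget⁺ tw (step w~u here)         = step (twins-adj tw w~u) here
  Walk-retarget⁺ tw (step w~x r@(step _ _)) = step w~x (Walk-retarget⁺ tw r)

  Walk-retarget : ∀ {u v w l} → NonAdjTwins G u v → w ≢ u → Walk G w u l → Walk G w v l
  Walk-retarget _  w≢u here         = ⊥-elim (w≢u refl)
  Walk-retarget tw _   r@(step _ _) = Walk-retarget⁺ tw r

  twins-walk₂ : ∀ {u v l} → u ≢ v → NonAdjTwins G u v → Walk G u v l → Walk G u v 2
  twins-walk₂ u≢v _  here         = ⊥-elim (u≢v refl)
  twins-walk₂ _   tw (step u~w _) = step u~w (step (twins-adj tw (sym G u~w)) here)

  twins-walk-length : ∀ {u v l} → u ≢ v → NonAdjTwins G u v → Walk G u v l → 2 ≤ l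
  twins-walk-length u≢v _         here                = ⊥-elim (u≢v refl)
  twins-walk-length _   (u≁v , _) (step u~v here)     = ⊥-elim (u≁v u~v)
  twins-walk-length _   _         (step _ (step _ _)) = s≤s (s≤s z≤n)

  module _ {d : Fin n → Fin n → ℕ} (D : IsDistance G d) where

    distance-self : ∀ u → d u u ≡ 0
    distance-self u = n≤0⇒n≡0 (proj₂ (D u u) 0 here)

    distance-twins : Connected G → ∀ {u v} → u ≢ v → NonAdjTwins G u v → d u v ≡ 2
    distance-twins conn {u} {v} u≢v tw =
      ≤-antisym (proj₂ (D u v) 2 (twins-walk₂ u≢v tw (proj₂ (conn u v))))
                (twins-walk-length u≢v tw (proj₁ (D u v)))

    distance-to-twins : ∀ {u v w} → NonAdjTwins G u v → w ≢ u → w ≢ v → d w u ≡ d w v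
    distance-to-twins {u} {v} {w} tw w≢u w≢v =
      ≤-antisym (proj₂ (D w u) _ (Walk-retarget (NonAdjTwins-sym tw) w≢v (proj₁ (D w v))))
                (proj₂ (D w v) _ (Walk-retarget tw w≢u (proj₁ (D w u))))

module _ {c ℓ : Level} (R : CommutativeRing c ℓ) where
  open CommutativeRing R
    using (Carrier; _≈_; _*_; -_; _-_; 0#; 1#; setoid; ring;
           +-cong; +-comm; +-assoc; +-identityˡ; +-identityʳ; -‿cong; -‿inverseʳ;
           *-cong; *-comm; *-assoc; *-identityʳ; zeroˡ; zeroʳ; distribʳ)
    renaming (_+_ to _⊕_; refl to ≈-refl; reflexive to ≈-reflexive; sym to ≈-sym; trans to ≈-trans)
  open RingProperties ring using (-0#≈0#; -‿involutive; -‿+-comm; -‿distribʳ-*)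
  open SetoidReasoning setoid

  ι-homo-+ : ∀ a b → ι R (a + b) ≈ ι R a ⊕ ι R b
  ι-homo-+ 0       b = ≈-sym (+-identityˡ _)
  ι-homo-+ (suc a) b = ≈-trans (+-cong ≈-refl (ι-homo-+ a b)) (≈-sym (+-assoc _ _ _))

  x*-1≈-x : ∀ x → x * - 1# ≈ - x
  x*-1≈-x x = ≈-trans (≈-sym (-‿distribʳ-* x 1#)) (-‿cong (*-identityʳ x))

  δ-diag : ∀ {n} (i : Fin n) → δ R i i ≡ 1#
  δ-diag zero    = refl
  δ-diag (suc i) = δ-diag i

  Σᴿ-zero : ∀ n (f : Fin n → Carrier) → (∀ j → f j ≈ 0#) → Σᴿ R n f ≈ 0#
  Σᴿ-zero 0       f f≈0 = ≈-refl
  Σᴿ-zero (suc n) f f≈0 = ≈-trans (+-cong (f≈0 zero) (Σᴿ-zero n _ (λ j → f≈0 (suc j)))) (+-identityʳ 0#)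

  mulVec-xVec : ∀ m (M : Fin (suc (suc m)) → Fin (suc (suc m)) → Carrier) i →
                mulVec R M (xVec R m) i ≈ M i zero - M i (suc zero)
  mulVec-xVec m M i = begin
    M i zero * 1# ⊕ (M i (suc zero) * - 1# ⊕ Σᴿ R m (λ j → M i (suc (suc j)) * 0#))
      ≈⟨ +-cong (*-identityʳ _) (+-cong (x*-1≈-x _) (Σᴿ-zero m _ (λ _ → zeroʳ _))) ⟩
    M i zero ⊕ (- M i (suc zero) ⊕ 0#)
      ≈⟨ +-cong ≈-refl (+-identityʳ _) ⟩
    M i zero - M i (suc zero) ∎

  ι-+-normalised : ∀ {k} a s → (s * s) * ι R k ≈ 1# → (ι R (k + a) * s) * s ≈ 1# ⊕ (s * ι R a) * s
  ι-+-normalised {k} a s ssk≈1 = begin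
    (ι R (k + a) * s) * s             ≈⟨ *-cong (*-cong (ι-homo-+ k a) ≈-refl) ≈-refl ⟩
    ((ι R k ⊕ ι R a) * s) * s         ≈⟨ *-cong (distribʳ s _ _) ≈-refl ⟩
    (ι R k * s ⊕ ι R a * s) * s       ≈⟨ distribʳ s _ _ ⟩
    (ι R k * s) * s ⊕ (ι R a * s) * s ≈⟨ +-cong (≈-trans (*-assoc _ s s) (*-comm _ _)) (*-cong (*-comm _ s) ≈-refl) ⟩
    (s * s) * ι R k ⊕ (s * ι R a) * s ≈⟨ +-cong ssk≈1 ≈-refl ⟩
    1# ⊕ (s * ι R a) * s              ∎

  module _ (isq : ℕ → Carrier) {m : ℕ} (d : Fin (suc (suc m)) → Fin (suc (suc m)) → ℕ) where
    private
      M : Fin (suc (suc m)) → Fin (suc (suc m)) → Carrier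
      M = normDistLap R isq d

    normDistLap-diag : ∀ i → d i i ≡ 0 → M i i ≈ 1#
    normDistLap-diag i dii≡0 rewrite δ-diag i | dii≡0 = begin
      1# - (isq t * 0#) * isq t ≈⟨ +-cong ≈-refl (-‿cong (≈-trans (*-cong (zeroʳ _) ≈-refl) (zeroˡ _))) ⟩
      1# - 0#                   ≈⟨ +-cong ≈-refl -0#≈0# ⟩
      1# ⊕ 0#                   ≈⟨ +-identityʳ 1# ⟩
      1#                        ∎
      where
      t : ℕ
      t = transmission d i

    normDistLap-twins : ∀ {i j k} → δ R i j ≡ 0# → transmission d i ≡ k → transmission d j ≡ k →
                        d i j ≡ 2 → M i j ≈ - ((isq k * ι R 2) * isq k)
    normDistLap-twins δij≡0 ti≡k tj≡k dij≡2 rewrite δij≡0 | ti≡k | tj≡k | dij≡2 = +-identityˡ _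

    module _ {k : ℕ} (ssk≈1 : (isq k * isq k) * ι R k ≈ 1#)
             (t₀≡k : transmission d zero ≡ k) (t₁≡k : transmission d (suc zero) ≡ k) where
      private
        e λ₂ : Carrier
        e  = (isq k * ι R 2) * isq k
        λ₂ = (ι R (k + 2) * isq k) * isq k

      mulVec-xVec-twin₀ : d zero zero ≡ 0 → d zero (suc zero) ≡ 2 →
                          mulVec R M (xVec R m) zero ≈ λ₂ * 1#
      mulVec-xVec-twin₀ d₀₀≡0 d₀₁≡2 = begin
        mulVec R M (xVec R m) zero  ≈⟨ mulVec-xVec m M zero ⟩
        M zero zero - M zero (suc zero)
          ≈⟨ +-cong (normDistLap-diag zero d₀₀≡0) (-‿cong (normDistLap-twins refl t₀≡k t₁≡k d₀₁≡2)) ⟩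
        1# - - e                    ≈⟨ +-cong ≈-refl (-‿involutive e) ⟩
        1# ⊕ e                      ≈⟨ ≈-sym (ι-+-normalised {k} 2 (isq k) ssk≈1) ⟩
        λ₂                          ≈⟨ ≈-sym (*-identityʳ λ₂) ⟩
        λ₂ * 1#                     ∎

      mulVec-xVec-twin₁ : d (suc zero) (suc zero) ≡ 0 → d (suc zero) zero ≡ 2 →
                          mulVec R M (xVec R m) (suc zero) ≈ λ₂ * - 1#
      mulVec-xVec-twin₁ d₁₁≡0 d₁₀≡2 = begin
        mulVec R M (xVec R m) (suc zero) ≈⟨ mulVec-xVec m M (suc zero) ⟩
        M (suc zero) zero - M (suc zero) (suc zero)
          ≈⟨ +-cong (normDistLap-twins refl t₁≡k t₀≡k d₁₀≡2) (-‿cong (normDistLap-diag (suc zero) d₁₁≡0)) ⟩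
        - e - 1#                         ≈⟨ -‿+-comm e 1# ⟩
        - (e ⊕ 1#)                       ≈⟨ -‿cong (+-comm e 1#) ⟩
        - (1# ⊕ e)                       ≈⟨ -‿cong (≈-sym (ι-+-normalised {k} 2 (isq k) ssk≈1)) ⟩
        - λ₂                             ≈⟨ ≈-sym (x*-1≈-x λ₂) ⟩
        λ₂ * - 1#                        ∎

    mulVec-xVec-equidistant : ∀ j → transmission d zero ≡ transmission d (suc zero) →
                              d (suc (suc j)) zero ≡ d (suc (suc j)) (suc zero) →
                              ∀ λ′ → mulVec R M (xVec R m) (suc (suc j)) ≈ λ′ * 0#
    mulVec-xVec-equidistant j t₀≡t₁ dⱼ₀≡dⱼ₁ λ′ = begin
      mulVec R M (xVec R m) i ≈⟨ mulVec-xVec m M i ⟩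
      M i zero - M i (suc zero)
        ≈⟨ +-cong ≈-refl (-‿cong (≈-reflexive (cong₂ (λ e t → 0# - (isq (transmission d i) * ι R e) * isq t)
                                                      (≡-sym dⱼ₀≡dⱼ₁) (≡-sym t₀≡t₁)))) ⟩
      M i zero - M i zero     ≈⟨ -‿inverseʳ _ ⟩
      0#                      ≈⟨ ≈-sym (zeroʳ λ′) ⟩
      λ′ * 0#                 ∎
      where i = suc (suc j)

mainTheorem9 : {c ℓ : Level} (R : CommutativeRing c ℓ) →
    ¬ (CommutativeRing._≈_ R (CommutativeRing.1# R) (CommutativeRing.0# R)) →
    (isq : ℕ → CommutativeRing.Carrier R) → IsInvSqrt R isq →
    (m : ℕ) (G : SimpleGraph (suc (suc m))) → Connected G →
    (d : Fin (suc (suc m)) → Fin (suc (suc m)) → ℕ) → IsDistance G d →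
    NonAdjTwins G zero (suc zero) →
    (k : ℕ) → transmission d zero ≡ k → transmission d (suc zero) ≡ k →
    IsEigenpair R (normDistLap R isq d)
      (CommutativeRing._*_ R (CommutativeRing._*_ R (ι R (k + 2)) (isq k)) (isq k))
      (xVec R m)
mainTheorem9 R 1≉0 isq isq-inv m G conn d D tw k t₀≡k t₁≡k = rows , λ x≈0 → 1≉0 (x≈0 zero)
  where
  v₁≢v₂ : zero ≢ suc zero
  v₁≢v₂ ()

  d₀₁≡2 : d zero (suc zero) ≡ 2
  d₀₁≡2 = distance-twins G D conn v₁≢v₂ tw

  0<k : 0 < k
  0<k = subst (0 <_) t₀≡k
          (<-≤-trans (s≤s z≤n) (subst (_≤ transmission d zero) d₀₁≡2 (sumℕ-term≤ _ (d zero) (suc zero))))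

  open CommutativeRing R using (_≈_; _*_)

  ssk≈1 : (isq k * isq k) * ι R k ≈ CommutativeRing.1# R
  ssk≈1 = isq-inv k 0<k

  rows : ∀ i → mulVec R (normDistLap R isq d) (xVec R m) i ≈ ((ι R (k + 2) * isq k) * isq k) * xVec R m i
  rows zero          = mulVec-xVec-twin₀ R isq d ssk≈1 t₀≡k t₁≡k (distance-self G D zero) d₀₁≡2
  rows (suc zero)    = mulVec-xVec-twin₁ R isq d ssk≈1 t₀≡k t₁≡k (distance-self G D (suc zero))
                         (distance-twins G D conn (≢-sym v₁≢v₂) (NonAdjTwins-sym G tw))
  rows (suc (suc j)) = mulVec-xVec-equidistant R isq d j (≡-trans t₀≡k (≡-sym t₁≡k))
                         (distance-to-twins G D tw (λ ()) (λ ())) _
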